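{- Suppose $n,t,k,\Delta \in \mathbb{N}\setminus \{1\}$. Suppose that $T$ is a tree on $n$ vertices with at most $t$ leaves and $\Delta(T)\leq \Delta$, and $X\subseteq V(T)$ is a $k$-independent set in $T$. Then (I) $T$ contains at least $n-2t$ vertices of degree $2$, and (II) $T$ contains a $k$-independent set $Y\supseteq X$ of size at least $(n-2t)/\Delta^{k}$ such that $Y\setminus X$ consists of vertices of degree $2$.
   Context: A set $I\subseteq V(G)$ is $k$-independent in $G$ if any two distinct vertices of $I$ are at distance at least $k$ in $G$. -}

module Defs where

open import Data.Nat using (ℕ; zero; suc; _+_; _≤_)
open import Data.Nat.Properties using (_≟_)
open import Data.Bool using (Bool; true; false; if_then_else_)
open import Data.Fin using (Fin)
open import Data.Fin.Subset using (Subset; _∈_)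
open import Data.List using (List; []; _∷_; _++_; length; map; filter; allFin)
open import Data.Nat.ListAction using (sum)
open import Data.List.Relation.Unary.Linked using (Linked)
open import Data.List.Relation.Unary.Unique.Propositional using (Unique)
open import Data.Product using (Σ; ∃; _×_)
open import Relation.Binary.PropositionalEquality using (_≡_; _≢_)
open import Relation.Nullary using (¬_)

record Graph (n : ℕ) : Set where
  field
    adj     : Fin n → Fin n → Bool
    adj-sym : ∀ u v → adj u v ≡ adj v u
    irrefl  : ∀ v → adj v v ≡ false

module _ {n : ℕ} (G : Graph n) where
  open Graph G

  Adj : Fin n → Fin n → Set
  Adj u v = adj u v ≡ true

  data Walk : Fin n → Fin n → ℕ → Set where
    here : ∀ {u} → Walk u u zero
    step : ∀ {u v w ℓ} → Adj u v → Walk v w ℓ → Walk u w (suc ℓ)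

  Connected : Set
  Connected = ∀ u v → ∃ λ ℓ → Walk u v ℓ

  IsCycle : Fin n → List (Fin n) → Set
  IsCycle v vs = (2 ≤ length vs) × Unique (v ∷ vs) × Linked Adj (v ∷ vs ++ v ∷ [])

  Acyclic : Set
  Acyclic = ∀ v vs → ¬ IsCycle v vs

  IsTree : Set
  IsTree = Connected × Acyclic

  degree : Fin n → ℕ
  degree v = sum (map (λ w → if adj v w then 1 else 0) (allFin n))

  #deg : ℕ → ℕ
  #deg d = length (filter (λ v → degree v ≟ d) (allFin n))

  #leaves : ℕ
  #leaves = #deg 1

  MaxDegree≤ : ℕ → Set
  MaxDegree≤ Δ = ∀ v → degree v ≤ Δ

  DistAtLeast : ℕ → Fin n → Fin n → Set
  DistAtLeast k u v = ∀ ℓ → Walk u v ℓ → k ≤ ℓ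

  Independent : ℕ → Subset n → Set
  Independent k I = ∀ u v → u ∈ I → v ∈ I → u ≢ v → DistAtLeast k u v

-- (I) In a tree every degree is at least 1 and the degrees sum to at most 2n: every nonempty
-- vertex set S of a forest contains a vertex with at most one neighbour in S (follow a path in S
-- until it gets stuck; it cannot close up into a cycle), and deleting that vertex removes at most
-- two of the edge ends inside S.  Hence
--   3n ≤ Σ_v (deg v + 2[deg v = 1] + [deg v = 2]) ≤ 2n + 2t + #deg 2.
-- (II) Starting from X, scan all vertices and add each degree-2 vertex at distance at least k
-- from everything chosen so far.  Afterwards every degree-2 vertex lies within distance k - 1 of
-- some chosen vertex, and such a ball has fewer than Δ^k vertices, so #deg 2 ≤ |Y| Δ^k.

module Submission where

open import Data.Bool as Bool using (Bool; true; false; if_then_else_; _∧_; _∨_; not)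
open import Data.Bool.Properties using (∨-zeroʳ)
open import Data.Empty using (⊥-elim)
open import Data.Fin as Fin using (Fin; zero; suc; _≟_; punchIn)
open import Data.Fin.Properties using (any?; pigeonhole; punchInᵢ≢i)
open import Data.Fin.Subset using (Subset; _∈_; _∉_; _⊆_; ∣_∣; inside; outside; _∪_; ⁅_⁆)
open import Data.Fin.Subset.Properties
  using (_∈?_; p⊆p∪q; x∈p∪q⁻; x∈p∪q⁺; x∈⁅x⁆; x∈⁅y⁆⇒x≡y)
open import Data.List using (List; []; _∷_; _++_; length; lookup; map; filter; tabulate; allFin; foldl)
open import Data.List.Membership.Propositional using () renaming (_∈_ to _∈ˡ_; _∉_ to _∉ˡ_)
open import Data.List.Membership.Propositional.Properties using (∈-∃++; ∈-lookup; ∈-allFin)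
open import Data.List.Properties using (length-++)
open import Data.List.Relation.Unary.All as All using (All; []; _∷_; head)
open import Data.List.Relation.Unary.All.Properties using (¬Any⇒All¬)
open import Data.List.Relation.Unary.AllPairs using (AllPairs; []; _∷_)
open import Data.List.Relation.Unary.Any using (here; there)
open import Data.List.Relation.Unary.Linked using (Linked; [-]; _∷_)
open import Data.List.Relation.Unary.Unique.Propositional using (Unique)
open import Data.Nat as ℕ using (ℕ; zero; suc; _+_; _*_; _∸_; _^_; _≤_; _<_; z≤n; s≤s; s≤s⁻¹)
open import Data.Nat.ListAction using () renaming (sum to sumˡ)
open import Data.Nat.Properties hiding (_≟_)
open import Algebra.Properties.Semiring.Sum +-*-semiring
  using (sum; sum-syntax; sum-cong-≗; sum-replicate-zero; ∑-distrib-+; ∑-comm;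
         *-distribˡ-sum; *-distribʳ-sum)
open import Data.Product using (Σ; ∃-syntax; _×_; _,_)
open import Data.Sum using (_⊎_; inj₁; inj₂)
open import Data.Vec using ([]; _∷_)
open import Data.Vec.Functional using (foldr)
open import Function using (_∘_)
open import Relation.Binary.PropositionalEquality
open import Relation.Nullary using (Dec; yes; no; does; ¬_; ¬?; _×-dec_; contradiction)
open import Relation.Nullary.Decidable using (dec-true)
open import Relation.Unary using (Pred; Decidable)

open import Defs

⟦_⟧ : Bool → ℕ
⟦ b ⟧ = if b then 1 else 0

⟦∧⟧ : ∀ a b → ⟦ a ∧ b ⟧ ≡ ⟦ a ⟧ * ⟦ b ⟧
⟦∧⟧ true  b = sym (+-identityʳ ⟦ b ⟧)
⟦∧⟧ false b = refl

⟦∧⟧≤ʳ : ∀ a b → ⟦ a ∧ b ⟧ ≤ ⟦ b ⟧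
⟦∧⟧≤ʳ true  b = ≤-refl
⟦∧⟧≤ʳ false b = z≤n

⟦∨⟧≤ : ∀ a b → ⟦ a ∨ b ⟧ ≤ ⟦ a ⟧ + ⟦ b ⟧
⟦∨⟧≤ true  b = s≤s z≤n
⟦∨⟧≤ false b = ≤-refl

⟦does⟧-mono : ∀ {a b} {A : Set a} {B : Set b} (A? : Dec A) (B? : Dec B) →
              (A → B) → ⟦ does A? ⟧ ≤ ⟦ does B? ⟧
⟦does⟧-mono (yes _) (yes _) _   = ≤-refl
⟦does⟧-mono (yes a) (no ¬b) A→B = contradiction (A→B a) ¬b
⟦does⟧-mono (no _)  _       _   = z≤n

∑-mono-≤ : ∀ {n} {f g : Fin n → ℕ} → (∀ i → f i ≤ g i) → sum f ≤ sum g
∑-mono-≤ {zero}  f≤g = z≤n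
∑-mono-≤ {suc n} f≤g = +-mono-≤ (f≤g zero) (∑-mono-≤ (f≤g ∘ suc))

term≤∑ : ∀ {n} (f : Fin n → ℕ) i → f i ≤ sum f
term≤∑ f zero    = m≤m+n (f zero) _
term≤∑ f (suc i) = ≤-trans (term≤∑ (f ∘ suc) i) (m≤n+m _ (f zero))

∑-const : ∀ n c → ∑[ i < n ] c ≡ n * c
∑-const zero    c = refl
∑-const (suc n) c = cong (c +_) (∑-const n c)

∑-single : ∀ {n} (v : Fin n) c → ∑[ u < n ] (if does (u ≟ v) then c else 0) ≡ c
∑-single {suc n} zero c = trans (cong (c +_) (sum-replicate-zero n)) (+-identityʳ c)
∑-single {suc n} (suc v) c = ∑-single v c

anyᶠ : ∀ {n} → (Fin n → Bool) → Bool
anyᶠ {n} = foldr _∨_ false {n}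

anyᶠ-intro : ∀ {n} (f : Fin n → Bool) i → f i ≡ true → anyᶠ f ≡ true
anyᶠ-intro f zero    fi = cong (_∨ anyᶠ (f ∘ suc)) fi
anyᶠ-intro f (suc i) fi = trans (cong (f zero ∨_) (anyᶠ-intro (f ∘ suc) i fi)) (∨-zeroʳ (f zero))

⟦anyᶠ⟧≤∑ : ∀ {n} (f : Fin n → Bool) → ⟦ anyᶠ f ⟧ ≤ ∑[ i < n ] ⟦ f i ⟧
⟦anyᶠ⟧≤∑ {zero}  f = z≤n
⟦anyᶠ⟧≤∑ {suc n} f =
  ≤-trans (⟦∨⟧≤ (f zero) _) (+-monoʳ-≤ ⟦ f zero ⟧ (⟦anyᶠ⟧≤∑ (f ∘ suc)))

sumˡ-map-tabulate : ∀ {A : Set} {n} (g : Fin n → A) (f : A → ℕ) →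
                    sumˡ (map f (tabulate g)) ≡ ∑[ i < n ] f (g i)
sumˡ-map-tabulate {n = zero}  g f = refl
sumˡ-map-tabulate {n = suc n} g f = cong (f (g zero) +_) (sumˡ-map-tabulate (g ∘ suc) f)

length-filter≡sumˡ : ∀ {A : Set} {p} {P : Pred A p} (P? : Decidable P) xs →
                     length (filter P? xs) ≡ sumˡ (map (λ x → ⟦ does (P? x) ⟧) xs)
length-filter≡sumˡ P? []       = refl
length-filter≡sumˡ P? (x ∷ xs) with does (P? x)
... | true  = cong suc (length-filter≡sumˡ P? xs)
... | false = length-filter≡sumˡ P? xs

∣p∣≡∑ : ∀ {n} (p : Subset n) → ∣ p ∣ ≡ ∑[ i < n ] ⟦ does (i ∈? p) ⟧
∣p∣≡∑ []            = refl
∣p∣≡∑ (inside  ∷ p) = cong suc (∣p∣≡∑ p)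
∣p∣≡∑ (outside ∷ p) = ∣p∣≡∑ p

∧-true⁻ : ∀ {a b} → a ∧ b ≡ true → a ≡ true × b ≡ true
∧-true⁻ {true} b≡true = refl , b≡true

∑⟦⟧≥2⇒∃-other : ∀ {n} (f : Fin n → Bool) → 2 ≤ ∑[ i < n ] ⟦ f i ⟧ →
                ∀ p → ∃[ i ] f i ≡ true × i ≢ p
∑⟦⟧≥2⇒∃-other f 2≤∑ p with any? (λ i → (f i Bool.≟ true) ×-dec ¬? (i ≟ p))
... | yes found = found
... | no none  =
  contradiction 2≤∑ (≤⇒≯ (≤-trans (∑-mono-≤ atMostAtP) (≤-reflexive (∑-single p 1))))
  where
  atMostAtP : ∀ i → ⟦ f i ⟧ ≤ ⟦ does (i ≟ p) ⟧
  atMostAtP i with f i in fi | i ≟ p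
  ... | false | _       = z≤n
  ... | true  | yes _   = ≤-refl
  ... | true  | no i≢p = ⊥-elim (none (i , fi , i≢p))

3≤d+2[d≡1]+[d≡2] : ∀ d → 1 ≤ d → 3 ≤ d + (2 * ⟦ does (d ℕ.≟ 1) ⟧ + ⟦ does (d ℕ.≟ 2) ⟧)
3≤d+2[d≡1]+[d≡2] 1                   _ = ≤-refl
3≤d+2[d≡1]+[d≡2] 2                   _ = ≤-refl
3≤d+2[d≡1]+[d≡2] (suc (suc (suc d))) _ = s≤s (s≤s (s≤s z≤n))

geometric : ℕ → ℕ → ℕ
geometric Δ zero    = 1
geometric Δ (suc r) = suc (Δ * geometric Δ r)

geometric<^ : ∀ {Δ} → 2 ≤ Δ → ∀ r → geometric Δ r < Δ ^ suc r
geometric<^ {Δ} 2≤Δ zero    = subst (2 ≤_) (sym (*-identityʳ Δ)) 2≤Δ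
geometric<^ {Δ} 2≤Δ (suc r) = begin
  2 + Δ * geometric Δ r
    ≤⟨ +-monoˡ-≤ (Δ * geometric Δ r) 2≤Δ ⟩
  Δ + Δ * geometric Δ r
    ≡⟨ *-suc Δ (geometric Δ r) ⟨
  Δ * suc (geometric Δ r)
    ≤⟨ *-monoʳ-≤ Δ (geometric<^ 2≤Δ r) ⟩
  Δ * Δ ^ suc r ∎
  where open ≤-Reasoning

All-prefix : ∀ {A : Set} {P : A → Set} xs {w bs} → All P (xs ++ w ∷ bs) → All P (xs ++ w ∷ [])
All-prefix []       (pw ∷ _)  = pw ∷ []
All-prefix (x ∷ xs) (px ∷ ps) = px ∷ All-prefix xs ps

AllPairs-prefix : ∀ {A : Set} {R : A → A → Set} xs {w bs} →
                  AllPairs R (xs ++ w ∷ bs) → AllPairs R (xs ++ w ∷ [])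
AllPairs-prefix []       (_ ∷ _)   = [] ∷ []
AllPairs-prefix (x ∷ xs) (px ∷ ps) = All-prefix xs px ∷ AllPairs-prefix xs ps

Linked-close : ∀ {A : Set} {R : A → A → Set} xs {w z bs} →
               Linked R (xs ++ w ∷ bs) → R w z → Linked R ((xs ++ w ∷ []) ++ z ∷ [])
Linked-close []           _       wz = wz ∷ [-]
Linked-close (x ∷ [])     (r ∷ _) wz = r ∷ wz ∷ [-]
Linked-close (x ∷ y ∷ xs) (r ∷ l) wz = r ∷ Linked-close (y ∷ xs) l wz

Unique-lookup-injective : ∀ {A : Set} {xs : List A} → Unique xs →
                          ∀ {i j} → i Fin.< j → lookup xs i ≢ lookup xs j
Unique-lookup-injective (x≢ ∷ _) {zero}  {suc j} _         = All.lookup x≢ (∈-lookup j)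
Unique-lookup-injective (_ ∷ u)  {suc i} {suc j} (s≤s i<j) = Unique-lookup-injective u i<j

Unique⇒length≤ : ∀ {n} {xs : List (Fin n)} → Unique xs → length xs ≤ n
Unique⇒length≤ {n} {xs} uniq with length xs ℕ.≤? n
... | yes ≤n = ≤n
... | no  >n with pigeonhole (≰⇒> >n) (lookup xs)
...   | i , j , i<j , same = ⊥-elim (Unique-lookup-injective uniq i<j same)

module _ {n : ℕ} (G : Graph n) where
  open Graph G

  degree≡∑ : ∀ v → degree G v ≡ ∑[ w < n ] ⟦ adj v w ⟧
  degree≡∑ v = sumˡ-map-tabulate (λ w → w) (λ w → ⟦ adj v w ⟧)

  #deg≡∑ : ∀ d → #deg G d ≡ ∑[ v < n ] ⟦ does (degree G v ℕ.≟ d) ⟧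
  #deg≡∑ d = trans (length-filter≡sumˡ (λ v → degree G v ℕ.≟ d) (allFin n))
                   (sumˡ-map-tabulate (λ v → v) (λ v → ⟦ does (degree G v ℕ.≟ d) ⟧))

  Adj-sym : ∀ {u v} → Adj G u v → Adj G v u
  Adj-sym {u} {v} uv = trans (adj-sym v u) uv

  Walk-length-zero : ∀ {u v} → Walk G u v 0 → u ≡ v
  Walk-length-zero here = refl

  Walk-snoc : ∀ {u v w ℓ} → Walk G u v ℓ → Adj G v w → Walk G u w (suc ℓ)
  Walk-snoc here       a = step a here
  Walk-snoc (step b p) a = step b (Walk-snoc p a)

  Walk-reverse : ∀ {u v ℓ} → Walk G u v ℓ → Walk G v u ℓ
  Walk-reverse here       = here
  Walk-reverse (step a p) = Walk-snoc (Walk-reverse p) (Adj-sym a)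

  DistAtLeast-sym : ∀ {k u v} → DistAtLeast G k u v → DistAtLeast G k v u
  DistAtLeast-sym d ℓ p = d ℓ (Walk-reverse p)

  connected⇒degree≥1 : 2 ≤ n → Connected G → ∀ v → 1 ≤ degree G v
  connected⇒degree≥1 (s≤s (s≤s z≤n)) connected v
    with connected v (punchIn v zero)
  ... | zero  , p = ⊥-elim (punchInᵢ≢i v zero (sym (Walk-length-zero p)))
  ... | suc ℓ , step {v = w} a _ =
    subst (1 ≤_) (sym (degree≡∑ v))
      (≤-trans (≤-reflexive (cong ⟦_⟧ (sym a))) (term≤∑ (λ w → ⟦ adj v w ⟧) w))

  -- Forests

  closing-edge⇒cycle : ∀ {x y w ys} → Unique (x ∷ y ∷ ys) → Linked (Adj G) (x ∷ y ∷ ys) →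
                       w ∈ˡ ys → Adj G w x → ∃[ vs ] IsCycle G x vs
  closing-edge⇒cycle {x} {y} {w} uniq linked w∈ys wx with ∈-∃++ w∈ys
  ... | as , bs , refl =
    y ∷ as ++ w ∷ [] ,
    s≤s (subst (1 ≤_) (sym (length-++ as)) (m≤n+m 1 (length as))) ,
    AllPairs-prefix (x ∷ y ∷ as) uniq ,
    Linked-close (x ∷ y ∷ as) linked wx

  degreeIn : (Fin n → Bool) → Fin n → ℕ
  degreeIn S u = ∑[ w < n ] ⟦ S w ∧ adj u w ⟧

  forest⇒low-degree : Acyclic G → ∀ S x → S x ≡ true → ∃[ v ] S v ≡ true × degreeIn S v ≤ 1
  forest⇒low-degree acyclic S x Sx = extendPath n x [] refl (Sx ∷ []) ([] ∷ []) [-]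
    where
    open import Data.List.Membership.DecPropositional (_≟_ {n}) using () renaming (_∈?_ to _∈ˡ?_)

    previous : Fin n → List (Fin n) → Fin n
    previous x []      = x
    previous x (y ∷ _) = y

    next∉path : ∀ {x w} ys → Unique (x ∷ ys) → Linked (Adj G) (x ∷ ys) →
                Adj G x w → w ≢ previous x ys → w ∉ˡ x ∷ ys
    next∉path ys _ _ xw _ (here refl) = contradiction (trans (sym (irrefl _)) xw) λ ()
    next∉path (y ∷ ys) _ _ _ w≢y (there (here refl)) = w≢y refl
    next∉path (y ∷ ys) uniq linked xw _ (there (there w∈ys)) =
      let vs , cycle = closing-edge⇒cycle uniq linked w∈ys (Adj-sym xw) in acyclic _ vs cycle

    -- x ∷ ys is a path inside S, newest vertex first.  It never repeats a vertex, so it has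
    -- at most n vertices; the fuel makes this bound structural.
    extendPath : ∀ fuel x ys → length ys + fuel ≡ n →
                 All (λ z → S z ≡ true) (x ∷ ys) → Unique (x ∷ ys) → Linked (Adj G) (x ∷ ys) →
                 ∃[ v ] S v ≡ true × degreeIn S v ≤ 1
    extendPath zero x ys len _ uniq _ =
      ⊥-elim (<⇒≢ (Unique⇒length≤ uniq) (trans (sym (+-identityʳ _)) len))
    extendPath (suc fuel) x ys len inS uniq linked with degreeIn S x ℕ.≤? 1
    ... | yes low = x , head inS , low
    ... | no high with ∑⟦⟧≥2⇒∃-other (λ w → S w ∧ adj x w) (≰⇒> high) (previous x ys)
    ...   | w , Sw∧xw , w≢prev with ∧-true⁻ Sw∧xw | w ∈ˡ? (x ∷ ys)
    ...     | _ , xw | yes w∈path = ⊥-elim (next∉path ys uniq linked xw w≢prev w∈path)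
    ...     | Sw , xw | no w∉path =
      extendPath fuel w (x ∷ ys) (trans (sym (+-suc (length ys) fuel)) len)
        (Sw ∷ inS) (¬Any⇒All¬ (x ∷ ys) w∉path ∷ uniq) (Adj-sym xw ∷ linked)

  size : (Fin n → Bool) → ℕ
  size S = ∑[ u < n ] ⟦ S u ⟧

  -- twice the number of edges inside S
  ∑degreeIn : (Fin n → Bool) → ℕ
  ∑degreeIn S = ∑[ u < n ] (if S u then degreeIn S u else 0)

  remove : Fin n → (Fin n → Bool) → Fin n → Bool
  remove v S u = not (does (u ≟ v)) ∧ S u

  degreeIn-remove : ∀ S v u → degreeIn S u ≤ degreeIn (remove v S) u + ⟦ adj u v ⟧
  degreeIn-remove S v u = begin
    degreeIn S u
      ≤⟨ ∑-mono-≤ split ⟩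
    ∑[ w < n ] (inRemoved w + atV w)
      ≡⟨ ∑-distrib-+ inRemoved atV ⟩
    degreeIn (remove v S) u + ∑[ w < n ] atV w
      ≡⟨ cong (degreeIn (remove v S) u +_) (∑-single v ⟦ adj u v ⟧) ⟩
    degreeIn (remove v S) u + ⟦ adj u v ⟧ ∎
    where
    open ≤-Reasoning
    inRemoved atV : Fin n → ℕ
    inRemoved w = ⟦ remove v S w ∧ adj u w ⟧
    atV w = if does (w ≟ v) then ⟦ adj u v ⟧ else 0

    split : ∀ w → ⟦ S w ∧ adj u w ⟧ ≤ inRemoved w + atV w
    split w with w ≟ v
    ... | yes refl = ⟦∧⟧≤ʳ (S w) (adj u w)
    ... | no _     = m≤m+n _ 0

  ∑degreeIn-remove : ∀ S v → ∑degreeIn S ≤ ∑degreeIn (remove v S) + (degreeIn S v + degreeIn S v)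
  ∑degreeIn-remove S v = begin
    ∑degreeIn S
      ≤⟨ ∑-mono-≤ {n} split ⟩
    ∑[ u < n ] (inRemoved u + (atV u + toV u))
      ≡⟨ ∑-distrib-+ inRemoved (λ u → atV u + toV u) ⟩
    ∑degreeIn (remove v S) + ∑[ u < n ] (atV u + toV u)
      ≡⟨ cong (∑degreeIn (remove v S) +_) (∑-distrib-+ atV toV) ⟩
    ∑degreeIn (remove v S) + (∑[ u < n ] atV u + ∑[ u < n ] toV u)
      ≡⟨ cong (λ e → ∑degreeIn (remove v S) + (e + sum toV)) (∑-single v (degreeIn S v)) ⟩
    ∑degreeIn (remove v S) + (degreeIn S v + ∑[ u < n ] toV u)
      ≡⟨ cong (λ e → ∑degreeIn (remove v S) + (degreeIn S v + e)) (sum-cong-≗ toV≡) ⟩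
    ∑degreeIn (remove v S) + (degreeIn S v + degreeIn S v) ∎
    where
    open ≤-Reasoning
    inRemoved atV toV : Fin n → ℕ
    inRemoved u = if remove v S u then degreeIn (remove v S) u else 0
    atV u = if does (u ≟ v) then degreeIn S v else 0
    toV u = ⟦ S u ∧ adj u v ⟧

    toV≡ : ∀ u → toV u ≡ ⟦ S u ∧ adj v u ⟧
    toV≡ u = cong (λ b → ⟦ S u ∧ b ⟧) (adj-sym u v)

    split : ∀ u → (if S u then degreeIn S u else 0) ≤ inRemoved u + (atV u + toV u)
    split u with u ≟ v | S u
    ... | yes refl | true  = m≤m+n _ _
    ... | yes refl | false = z≤n
    ... | no _     | true  = degreeIn-remove S v u
    ... | no _     | false = z≤n

  size-remove : ∀ S v → S v ≡ true → size S ≡ suc (size (remove v S))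
  size-remove S v Sv = begin
    size S
      ≡⟨ sum-cong-≗ split ⟩
    ∑[ u < n ] (⟦ does (u ≟ v) ⟧ + ⟦ remove v S u ⟧)
      ≡⟨ ∑-distrib-+ (λ u → ⟦ does (u ≟ v) ⟧) (λ u → ⟦ remove v S u ⟧) ⟩
    ∑[ u < n ] ⟦ does (u ≟ v) ⟧ + size (remove v S)
      ≡⟨ cong (_+ size (remove v S)) (∑-single v 1) ⟩
    suc (size (remove v S)) ∎
    where
    open ≡-Reasoning
    split : ∀ u → ⟦ S u ⟧ ≡ ⟦ does (u ≟ v) ⟧ + ⟦ remove v S u ⟧
    split u with u ≟ v
    ... | yes refl = cong ⟦_⟧ Sv
    ... | no _     = refl

  forest⇒∑degreeIn≤ : Acyclic G → ∀ m S → size S ≤ m → ∑degreeIn S ≤ 2 * size S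
  forest⇒∑degreeIn≤ acyclic m S size≤m with any? (λ u → S u Bool.≟ true)
  ... | no noMember =
    ≤-trans (∑-mono-≤ {n} vanish) (≤-trans (≤-reflexive (sum-replicate-zero n)) z≤n)
    where
    vanish : ∀ u → (if S u then degreeIn S u else 0) ≤ 0
    vanish u with S u in Su
    ... | true  = ⊥-elim (noMember (u , Su))
    ... | false = z≤n
  ... | yes (x , Sx) with forest⇒low-degree acyclic S x Sx | m
  ...   | v , Sv , _ | zero =
    contradiction (≤-trans (subst (_≤ size S) (cong ⟦_⟧ Sv) (term≤∑ (λ u → ⟦ S u ⟧) v)) size≤m)
                  λ ()
  ...   | v , Sv , low | suc m = begin
    ∑degreeIn S
      ≤⟨ ∑degreeIn-remove S v ⟩
    ∑degreeIn (remove v S) + (degreeIn S v + degreeIn S v)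
      ≤⟨ +-mono-≤ (forest⇒∑degreeIn≤ acyclic m (remove v S) smaller) (+-mono-≤ low low) ⟩
    2 * size (remove v S) + 2
      ≡⟨ +-comm _ 2 ⟩
    2 + 2 * size (remove v S)
      ≡⟨ *-suc 2 (size (remove v S)) ⟨
    2 * suc (size (remove v S))
      ≡⟨ cong (2 *_) (size-remove S v Sv) ⟨
    2 * size S ∎
    where
    open ≤-Reasoning
    smaller : size (remove v S) ≤ m
    smaller = s≤s⁻¹ (subst (_≤ suc m) (size-remove S v Sv) size≤m)

  forest⇒∑degree≤ : Acyclic G → ∑[ v < n ] degree G v ≤ 2 * n
  forest⇒∑degree≤ acyclic = begin
    ∑[ v < n ] degree G v
      ≡⟨ sum-cong-≗ degree≡∑ ⟩
    ∑degreeIn (λ _ → true)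
      ≤⟨ forest⇒∑degreeIn≤ acyclic n (λ _ → true) (≤-reflexive size≡n) ⟩
    2 * size (λ _ → true)
      ≡⟨ cong (2 *_) size≡n ⟩
    2 * n ∎
    where
    open ≤-Reasoning
    size≡n : size (λ _ → true) ≡ n
    size≡n = trans (∑-const n 1) (*-identityʳ n)

  tree⇒n≤2#leaves+#deg2 : 2 ≤ n → IsTree G → n ≤ 2 * #leaves G + #deg G 2
  tree⇒n≤2#leaves+#deg2 2≤n (connected , acyclic) = +-cancelˡ-≤ (2 * n) n _ (begin
    2 * n + n
      ≡⟨ trans (+-comm (2 * n) n) (*-comm 3 n) ⟩
    n * 3
      ≡⟨ ∑-const n 3 ⟨
    ∑[ v < n ] 3
      ≤⟨ ∑-mono-≤ (λ v → 3≤d+2[d≡1]+[d≡2] (degree G v) (connected⇒degree≥1 2≤n connected v)) ⟩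
    ∑[ v < n ] (degree G v + (2 * ones v + twos v))
      ≡⟨ ∑-distrib-+ (degree G) _ ⟩
    ∑deg + ∑[ v < n ] (2 * ones v + twos v)
      ≡⟨ cong (∑deg +_) (∑-distrib-+ (λ v → 2 * ones v) twos) ⟩
    ∑deg + (∑[ v < n ] (2 * ones v) + sum twos)
      ≡⟨ cong (λ e → ∑deg + (e + sum twos)) (*-distribˡ-sum 2 ones) ⟨
    ∑deg + (2 * sum ones + sum twos)
      ≡⟨ cong₂ (λ a b → ∑deg + (2 * a + b)) (#deg≡∑ 1) (#deg≡∑ 2) ⟨
    ∑deg + (2 * #leaves G + #deg G 2)
      ≤⟨ +-monoˡ-≤ _ (forest⇒∑degree≤ acyclic) ⟩
    2 * n + (2 * #leaves G + #deg G 2)                 ∎)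
    where
    open ≤-Reasoning
    ∑deg : ℕ
    ∑deg = ∑[ v < n ] degree G v
    ones twos : Fin n → ℕ
    ones v = ⟦ does (degree G v ℕ.≟ 1) ⟧
    twos v = ⟦ does (degree G v ℕ.≟ 2) ⟧

  -- Balls

  -- ball r y w holds iff some walk of length at most r leads from y to w
  ball : ℕ → Fin n → Fin n → Bool
  ball zero    y w = does (w ≟ y)
  ball (suc r) y w = does (w ≟ y) ∨ anyᶠ (λ v → adj y v ∧ ball r v w)

  walk⇒ball : ∀ r {y w ℓ} → Walk G y w ℓ → ℓ ≤ r → ball r y w ≡ true
  walk⇒ball zero    {y} here _ = dec-true (y ≟ y) refl
  walk⇒ball (suc r) {y} here _ =
    cong (_∨ anyᶠ (λ v → adj y v ∧ ball r v y)) (dec-true (y ≟ y) refl)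
  walk⇒ball (suc r) {y} {w} (step {v = v} yv p) (s≤s ℓ≤r) =
    trans (cong (does (w ≟ y) ∨_) (anyᶠ-intro _ v (cong₂ _∧_ yv (walk⇒ball r p ℓ≤r)))) (∨-zeroʳ _)

  ∣ball∣≤geometric : ∀ {Δ} → MaxDegree≤ G Δ →
                     ∀ r y → ∑[ w < n ] ⟦ ball r y w ⟧ ≤ geometric Δ r
  ∣ball∣≤geometric maxDeg zero    y = ≤-reflexive (∑-single y 1)
  ∣ball∣≤geometric {Δ} maxDeg (suc r) y = begin
    ∑[ w < n ] ⟦ ball (suc r) y w ⟧
      ≤⟨ ∑-mono-≤ split ⟩
    ∑[ w < n ] (⟦ does (w ≟ y) ⟧ + ∑[ v < n ] viaV v w)
      ≡⟨ ∑-distrib-+ (λ w → ⟦ does (w ≟ y) ⟧) _ ⟩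
    ∑[ w < n ] ⟦ does (w ≟ y) ⟧ + ∑[ w < n ] ∑[ v < n ] viaV v w
      ≡⟨ cong₂ _+_ (∑-single y 1) (∑-comm (λ w v → viaV v w)) ⟩
    1 + ∑[ v < n ] ∑[ w < n ] viaV v w
      ≡⟨ cong (1 +_) (sum-cong-≗ factor) ⟩
    1 + ∑[ v < n ] (⟦ adj y v ⟧ * ∑[ w < n ] ⟦ ball r v w ⟧)
      ≤⟨ +-monoʳ-≤ 1 (∑-mono-≤ λ v → *-monoʳ-≤ ⟦ adj y v ⟧ (∣ball∣≤geometric maxDeg r v)) ⟩
    1 + ∑[ v < n ] (⟦ adj y v ⟧ * geometric Δ r)
      ≡⟨ cong (1 +_) (*-distribʳ-sum (geometric Δ r) (λ v → ⟦ adj y v ⟧)) ⟨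
    1 + ∑[ v < n ] ⟦ adj y v ⟧ * geometric Δ r
      ≡⟨ cong (λ d → 1 + d * geometric Δ r) (degree≡∑ y) ⟨
    1 + degree G y * geometric Δ r
      ≤⟨ +-monoʳ-≤ 1 (*-monoˡ-≤ (geometric Δ r) (maxDeg y)) ⟩
    1 + Δ * geometric Δ r ∎
    where
    open ≤-Reasoning
    viaV : Fin n → Fin n → ℕ
    viaV v w = ⟦ adj y v ∧ ball r v w ⟧
    split : ∀ w → ⟦ ball (suc r) y w ⟧ ≤ ⟦ does (w ≟ y) ⟧ + ∑[ v < n ] viaV v w
    split w = ≤-trans (⟦∨⟧≤ (does (w ≟ y)) _)
                      (+-monoʳ-≤ ⟦ does (w ≟ y) ⟧ (⟦anyᶠ⟧≤∑ (λ v → adj y v ∧ ball r v w)))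
    factor : ∀ v → ∑[ w < n ] viaV v w ≡ ⟦ adj y v ⟧ * ∑[ w < n ] ⟦ ball r v w ⟧
    factor v = trans (sum-cong-≗ λ w → ⟦∧⟧ (adj y v) (ball r v w))
                     (sym (*-distribˡ-sum ⟦ adj y v ⟧ (λ w → ⟦ ball r v w ⟧)))

  -- Greedy extension of a (suc r)-independent set

  module _ (r : ℕ) where

    Near : Subset n → Fin n → Set
    Near Y v = ∃[ y ] y ∈ Y × ball r y v ≡ true

    near? : ∀ Y v → Dec (Near Y v)
    near? Y v = any? λ y → (y ∈? Y) ×-dec (ball r y v Bool.≟ true)

    Near-mono : ∀ {Y Y′ v} → Y ⊆ Y′ → Near Y v → Near Y′ v
    Near-mono Y⊆Y′ (y , y∈Y , b) = y , Y⊆Y′ y∈Y , b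

    ¬Near⇒DistAtLeast : ∀ {Y v y} → ¬ Near Y v → y ∈ Y → DistAtLeast G (suc r) y v
    ¬Near⇒DistAtLeast ¬near y∈Y ℓ p with suc r ℕ.≤? ℓ
    ... | yes k≤ℓ = k≤ℓ
    ... | no  k≰ℓ = ⊥-elim (¬near (_ , y∈Y , walk⇒ball r p (s≤s⁻¹ (≰⇒> k≰ℓ))))

    ∪⁅⁆-independent : ∀ {Y v} → Independent G (suc r) Y → ¬ Near Y v →
                      Independent G (suc r) (Y ∪ ⁅ v ⁆)
    ∪⁅⁆-independent {Y} {v} indY ¬near u w u∈ w∈ u≢w
      with x∈p∪q⁻ Y ⁅ v ⁆ u∈ | x∈p∪q⁻ Y ⁅ v ⁆ w∈
    ... | inj₁ u∈Y | inj₁ w∈Y = indY u w u∈Y w∈Y u≢w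
    ... | inj₁ u∈Y | inj₂ w∈v rewrite x∈⁅y⁆⇒x≡y v w∈v = ¬Near⇒DistAtLeast ¬near u∈Y
    ... | inj₂ u∈v | inj₁ w∈Y rewrite x∈⁅y⁆⇒x≡y v u∈v =
      DistAtLeast-sym (¬Near⇒DistAtLeast ¬near w∈Y)
    ... | inj₂ u∈v | inj₂ w∈v =
      ⊥-elim (u≢w (trans (x∈⁅y⁆⇒x≡y v u∈v) (sym (x∈⁅y⁆⇒x≡y v w∈v))))

    extend : Subset n → Fin n → Subset n
    extend Y v with degree G v ℕ.≟ 2 | near? Y v
    ... | yes _ | no _ = Y ∪ ⁅ v ⁆
    ... | _     | _    = Y

    ⊆-extend : ∀ Y v → Y ⊆ extend Y v
    ⊆-extend Y v with degree G v ℕ.≟ 2 | near? Y v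
    ... | yes _ | no _  = p⊆p∪q ⁅ v ⁆
    ... | yes _ | yes _ = λ u∈Y → u∈Y
    ... | no _  | _     = λ u∈Y → u∈Y

    extend-independent : ∀ Y v → Independent G (suc r) Y → Independent G (suc r) (extend Y v)
    extend-independent Y v indY with degree G v ℕ.≟ 2 | near? Y v
    ... | yes _ | no ¬near = ∪⁅⁆-independent indY ¬near
    ... | yes _ | yes _    = indY
    ... | no _  | _        = indY

    extend-new : ∀ Y v u → u ∈ extend Y v → u ∈ Y ⊎ degree G u ≡ 2
    extend-new Y v u u∈ with degree G v ℕ.≟ 2 | near? Y v
    ... | yes deg2 | no _ with x∈p∪q⁻ Y ⁅ v ⁆ u∈
    ...   | inj₁ u∈Y = inj₁ u∈Y
    ...   | inj₂ u∈v = inj₂ (subst (λ x → degree G x ≡ 2) (sym (x∈⁅y⁆⇒x≡y v u∈v)) deg2)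
    extend-new Y v u u∈ | yes _ | yes _ = inj₁ u∈
    extend-new Y v u u∈ | no _  | _     = inj₁ u∈

    extend-covers : ∀ Y v → degree G v ≡ 2 → Near (extend Y v) v
    extend-covers Y v deg2 with degree G v ℕ.≟ 2 | near? Y v
    ... | yes _   | no _    = v , x∈p∪q⁺ (inj₂ (x∈⁅x⁆ v)) , walk⇒ball r here z≤n
    ... | yes _   | yes near = near
    ... | no ¬deg2 | _      = ⊥-elim (¬deg2 deg2)

    greedy : Subset n → List (Fin n) → Subset n
    greedy = foldl extend

    ⊆-greedy : ∀ Y vs → Y ⊆ greedy Y vs
    ⊆-greedy Y []       = λ u∈Y → u∈Y
    ⊆-greedy Y (v ∷ vs) = ⊆-greedy (extend Y v) vs ∘ ⊆-extend Y v

    greedy-independent : ∀ Y vs → Independent G (suc r) Y → Independent G (suc r) (greedy Y vs)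
    greedy-independent Y []       indY = indY
    greedy-independent Y (v ∷ vs) indY = greedy-independent (extend Y v) vs (extend-independent Y v indY)

    greedy-new : ∀ Y vs u → u ∈ greedy Y vs → u ∈ Y ⊎ degree G u ≡ 2
    greedy-new Y []       u u∈ = inj₁ u∈
    greedy-new Y (v ∷ vs) u u∈ with greedy-new (extend Y v) vs u u∈
    ... | inj₁ u∈ext = extend-new Y v u u∈ext
    ... | inj₂ deg2  = inj₂ deg2

    greedy-covers : ∀ Y vs v → v ∈ˡ vs → degree G v ≡ 2 → Near (greedy Y vs) v
    greedy-covers Y (v ∷ vs) .v (here refl) deg2 =
      Near-mono (⊆-greedy (extend Y v) vs) (extend-covers Y v deg2)
    greedy-covers Y (x ∷ vs) v  (there v∈) deg2  = greedy-covers (extend Y x) vs v v∈ deg2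

    ∑near≤ : ∀ {B} Y → (∀ y → ∑[ w < n ] ⟦ ball r y w ⟧ ≤ B) →
             ∑[ v < n ] ⟦ does (near? Y v) ⟧ ≤ ∣ Y ∣ * B
    ∑near≤ {B} Y ∣ball∣≤B = begin
      ∑[ v < n ] ⟦ does (near? Y v) ⟧
        ≤⟨ ∑-mono-≤ witness ⟩
      ∑[ v < n ] ∑[ y < n ] (member y * ⟦ ball r y v ⟧)
        ≡⟨ ∑-comm (λ v y → member y * ⟦ ball r y v ⟧) ⟩
      ∑[ y < n ] ∑[ v < n ] (member y * ⟦ ball r y v ⟧)
        ≡⟨ sum-cong-≗ (λ y → *-distribˡ-sum (member y) (λ v → ⟦ ball r y v ⟧)) ⟨
      ∑[ y < n ] (member y * ∑[ v < n ] ⟦ ball r y v ⟧)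
        ≤⟨ ∑-mono-≤ (λ y → *-monoʳ-≤ (member y) (∣ball∣≤B y)) ⟩
      ∑[ y < n ] (member y * B)
        ≡⟨ *-distribʳ-sum B member ⟨
      ∑[ y < n ] member y * B
        ≡⟨ cong (_* B) (∣p∣≡∑ Y) ⟨
      ∣ Y ∣ * B ∎
      where
      open ≤-Reasoning
      member : Fin n → ℕ
      member y = ⟦ does (y ∈? Y) ⟧
      witness : ∀ v → ⟦ does (near? Y v) ⟧ ≤ ∑[ y < n ] (member y * ⟦ ball r y v ⟧)
      witness v with near? Y v
      ... | no _                = z≤n
      ... | yes (y , y∈Y , yv) =
        ≤-trans (≤-reflexive (sym (cong₂ (λ a b → ⟦ a ⟧ * ⟦ b ⟧) (dec-true (y ∈? Y) y∈Y) yv)))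
                (term≤∑ (λ y → member y * ⟦ ball r y v ⟧) y)

  independent-extension : ∀ r {Δ} → 2 ≤ Δ → MaxDegree≤ G Δ →
    (X : Subset n) → Independent G (suc r) X →
    Σ (Subset n) λ Y → X ⊆ Y × Independent G (suc r) Y × #deg G 2 ≤ ∣ Y ∣ * Δ ^ suc r
                       × (∀ v → v ∈ Y → v ∉ X → degree G v ≡ 2)
  independent-extension r {Δ} 2≤Δ maxDeg X indX =
    Y , ⊆-greedy r X (allFin n) , greedy-independent r X (allFin n) indX , count , new
    where
    Y : Subset n
    Y = greedy r X (allFin n)

    covered : ∀ v → ⟦ does (degree G v ℕ.≟ 2) ⟧ ≤ ⟦ does (near? r Y v) ⟧
    covered v = ⟦does⟧-mono (degree G v ℕ.≟ 2) (near? r Y v)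
                            (greedy-covers r X (allFin n) v (∈-allFin v))

    count : #deg G 2 ≤ ∣ Y ∣ * Δ ^ suc r
    count = begin
      #deg G 2
        ≡⟨ #deg≡∑ 2 ⟩
      ∑[ v < n ] ⟦ does (degree G v ℕ.≟ 2) ⟧
        ≤⟨ ∑-mono-≤ covered ⟩
      ∑[ v < n ] ⟦ does (near? r Y v) ⟧
        ≤⟨ ∑near≤ r Y (λ y → ≤-trans (∣ball∣≤geometric maxDeg r y) (<⇒≤ (geometric<^ 2≤Δ r))) ⟩
      ∣ Y ∣ * Δ ^ suc r ∎
      where open ≤-Reasoning

    new : ∀ v → v ∈ Y → v ∉ X → degree G v ≡ 2
    new v v∈Y v∉X with greedy-new r X (allFin n) v v∈Y
    ... | inj₁ v∈X = contradiction v∈X v∉X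
    ... | inj₂ deg2 = deg2

proposition6p1 : (n t k Δ : ℕ) → 2 ≤ n → 2 ≤ t → 2 ≤ k → 2 ≤ Δ →
    (T : Graph n) → IsTree T → #leaves T ≤ t → MaxDegree≤ T Δ →
    (X : Subset n) → Independent T k X →
    (n ∸ 2 * t ≤ #deg T 2)
    × Σ (Subset n) (λ Y → (X ⊆ Y) × Independent T k Y
        × (n ∸ 2 * t ≤ ∣ Y ∣ * Δ ^ k)
        × (∀ v → v ∈ Y → v ∉ X → degree T v ≡ 2))
proposition6p1 n t (suc r) Δ 2≤n _ _ 2≤Δ T tree leaves≤t maxDeg X indX
  with independent-extension T r 2≤Δ maxDeg X indX
... | Y , X⊆Y , indY , #deg2≤ , new =
  n∸2t≤#deg2 , Y , X⊆Y , indY , ≤-trans n∸2t≤#deg2 #deg2≤ , new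
  where
  n∸2t≤#deg2 : n ∸ 2 * t ≤ #deg T 2
  n∸2t≤#deg2 = m≤n+o⇒m∸n≤o n (2 * t)
    (≤-trans (tree⇒n≤2#leaves+#deg2 T 2≤n tree) (+-monoˡ-≤ (#deg T 2) (*-monoʳ-≤ 2 leaves≤t)))
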